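{- Let $p$ be a prime. There exist a triple of positive integers $(x,y,z)$ with $\frac4p=\frac1x+\frac1y+\frac1z$ and positive integers $d,u,v,D,U,V$ such that the triple $(x,y,z)$ equals both $(du,dv,duv)$ and $(DUV,DUp,DVp)$ (up to the order of entries) if and only if $p\equiv -1\pmod{4d-1}$ for some positive integer $d$.
   Context: A solution of the form $(du,dv,duv)$ is called Type A and one of the form $(DUV,DUp,DVp)$ is called Type B; the claim characterizes primes having a solution that is simultaneously of Type A and of Type B. -}

module Defs where

open import Data.Nat using (ℕ; _+_; _*_)
open import Data.List using (List; _∷_; [])
open import Data.List.Relation.Binary.Permutation.Propositional using (_↭_)
open import Relation.Binary.PropositionalEquality using (_≡_)

-- 4/p = 1/x + 1/y + 1/z, with denominators cleared (all of p,x,y,z positive)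
ESSolution : ℕ → ℕ → ℕ → ℕ → Set
ESSolution p x y z = 4 * x * y * z ≡ p * (y * z + x * z + x * y)

SameUpToOrder : ℕ → ℕ → ℕ → ℕ → ℕ → ℕ → Set
SameUpToOrder x y z a b c = (x ∷ y ∷ z ∷ []) ↭ (a ∷ b ∷ c ∷ [])

{-# OPTIONS --safe #-}
module Submission where

open import Defs
open import Algebra.Properties.CommutativeSemigroup using (xy∙z≈xz∙y)
open import Data.Empty using (⊥-elim)
open import Data.List using (List; _∷_; [])
open import Data.List.Membership.Propositional using (_∈_)
open import Data.List.Relation.Binary.Permutation.Propositional as ↭ using (_↭_; ↭-refl; ↭-reflexive; ↭-sym)
open import Data.List.Relation.Binary.Permutation.Propositional.Properties using (All-resp-↭; ∈-resp-↭)
open import Data.List.Relation.Unary.All using (All; _∷_; [])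
open import Data.List.Relation.Unary.Any using (here; there)
open import Data.Nat using (ℕ; suc; zero; _+_; _*_; _∸_; _<_; _≤_; z<s; >-nonZero; >-nonZero⁻¹)
open import Data.Nat.Divisibility using (_∣_; divides; ∣⇒≤; ∣-refl; m∣m*n; *-cancelˡ-∣)
open import Data.Nat.ListAction using (sum; product)
open import Data.Nat.ListAction.Properties using (sum-↭; product-↭)
open import Data.Nat.Primality using (Prime; prime⇒irreducible; prime⇒nonZero)
open import Data.Nat.Properties
open import Data.Nat.Tactic.RingSolver using (solve-∀)
open import Data.Product using (_×_; _,_; ∃-syntax)
open import Data.Sum using (_⊎_; inj₁; inj₂; [_,_]′)
open import Function.Bundles using (_⇔_; mk⇔; Equivalence)
open import Relation.Binary.Definitions using (_Respects_)
open import Relation.Binary.PropositionalEquality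
open import Relation.Binary.Core using (_Preserves_⟶_)

-- Cleared of denominators, 4/p = 1/x + 1/y + 1/z reads 4xyz = p·e₂(x,y,z), with e₂ the second
-- elementary symmetric function, so the Type B triple (DUV, DUp, DVp) is itself a solution;
-- cancelling D²UVp², this says p + U + V = 4DUV, which forces U, V < p. The entry duv of the Type A
-- triple is divisible by all three entries. Among DUV, DUp, DVp it cannot be DUV (else p ∣ V), so it
-- is DUp or DVp, making V (resp. U) a proper divisor of p, hence 1; then p + 1 = U(4D - 1)
-- (resp. V(4D - 1)).

e₂ : List ℕ → ℕ
e₂ []       = 0
e₂ (x ∷ xs) = x * sum xs + e₂ xs

e₂-↭ : e₂ Preserves _↭_ ⟶ _≡_
e₂-↭ ↭.refl                = refl
e₂-↭ (↭.prep x xs↭ys)      = cong₂ _+_ (cong (x *_) (sum-↭ xs↭ys)) (e₂-↭ xs↭ys)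
e₂-↭ (↭.swap x y xs↭ys)    = trans (exchange x y _ _)
  (cong₂ (λ s e → y * (x + s) + (x * s + e)) (sum-↭ xs↭ys) (e₂-↭ xs↭ys))
  where
  exchange : ∀ x y s e → x * (y + s) + (y * s + e) ≡ y * (x + s) + (x * s + e)
  exchange = solve-∀
e₂-↭ (↭.trans xs↭ys ys↭zs) = trans (e₂-↭ xs↭ys) (e₂-↭ ys↭zs)

ESSolution-resp-↭ : ∀ p {x y z a b c} → SameUpToOrder x y z a b c →
                    ESSolution p x y z → ESSolution p a b c
ESSolution-resp-↭ p {x} {y} {z} {a} {b} {c} σ es = begin
  4 * a * b * c                ≡⟨ product-form a b c ⟩
  4 * product (a ∷ b ∷ c ∷ []) ≡⟨ cong (4 *_) (product-↭ σ) ⟨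
  4 * product (x ∷ y ∷ z ∷ []) ≡⟨ product-form x y z ⟨
  4 * x * y * z                ≡⟨ es ⟩
  p * (y * z + x * z + x * y)  ≡⟨ cong (p *_) (e₂-form x y z) ⟩
  p * e₂ (x ∷ y ∷ z ∷ [])      ≡⟨ cong (p *_) (e₂-↭ σ) ⟩
  p * e₂ (a ∷ b ∷ c ∷ [])      ≡⟨ cong (p *_) (e₂-form a b c) ⟨
  p * (b * c + a * c + a * b)  ∎
  where
  open ≡-Reasoning
  product-form : ∀ x y z → 4 * x * y * z ≡ 4 * (x * (y * (z * 1)))
  product-form = solve-∀
  e₂-form : ∀ x y z → y * z + x * z + x * y ≡ x * (y + (z + 0)) + (y * (z + 0) + (z * 0 + 0))
  e₂-form = solve-∀

typeB-product : ∀ p D U V →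
  4 * (D * U * V) * (D * U * p) * (D * V * p) ≡ D * D * U * V * p * p * (4 * D * U * V)
typeB-product = solve-∀

typeB-e₂ : ∀ p D U V →
  p * ((D * U * p) * (D * V * p) + (D * U * V) * (D * V * p) + (D * U * V) * (D * U * p))
    ≡ D * D * U * V * p * p * (p + U + V)
typeB-e₂ = solve-∀

typeB-equation⇒solution : ∀ {p D U V} → p + U + V ≡ 4 * D * U * V →
                 ESSolution p (D * U * V) (D * U * p) (D * V * p)
typeB-equation⇒solution {p} {D} {U} {V} eq = begin
  4 * (D * U * V) * (D * U * p) * (D * V * p) ≡⟨ typeB-product p D U V ⟩
  D * D * U * V * p * p * (4 * D * U * V)     ≡⟨ cong (D * D * U * V * p * p *_) eq ⟨
  D * D * U * V * p * p * (p + U + V)         ≡⟨ typeB-e₂ p D U V ⟨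
  p * ((D * U * p) * (D * V * p) + (D * U * V) * (D * V * p) + (D * U * V) * (D * U * p)) ∎
  where open ≡-Reasoning

typeB-solution⇒equation : ∀ {p D U V} → 0 < p → 0 < D → 0 < U → 0 < V →
                   ESSolution p (D * U * V) (D * U * p) (D * V * p) → p + U + V ≡ 4 * D * U * V
typeB-solution⇒equation {p} {D} {U} {V} z<s z<s z<s z<s es =
  *-cancelˡ-≡ _ _ (D * D * U * V * p * p)
    (trans (sym (typeB-e₂ p D U V)) (trans (sym es) (typeB-product p D U V)))

typeB-equation⇒V<p : ∀ {p D U V} → 0 < p → 0 < D → 0 < U → p + U + V ≡ 4 * D * U * V → V < p
typeB-equation⇒V<p {p} {D} {U} {V} 0<p 0<D 0<U eq = ≰⇒> (λ p≤V → <-irrefl eq (too-large p≤V))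
  where
  open ≤-Reasoning
  triple : ∀ n → n + n + n ≡ 3 * n
  triple = solve-∀
  too-large : p ≤ V → p + U + V < 4 * D * U * V
  too-large p≤V = begin-strict
    p + U + V             ≤⟨ +-monoˡ-≤ V (+-monoˡ-≤ U p≤V) ⟩
    V + U + V             ≤⟨ +-mono-≤ (+-mono-≤ (m≤n*m V U) (m≤m*n U V)) (m≤n*m V U) ⟩
    U * V + U * V + U * V ≡⟨ triple (U * V) ⟩
    3 * (U * V)           <⟨ *-monoˡ-< (U * V) (n<1+n 3) ⟩
    4 * (U * V)           ≤⟨ *-monoˡ-≤ (U * V) (m≤m*n 4 D) ⟩
    4 * D * (U * V)       ≡⟨ *-assoc (4 * D) U V ⟨
    4 * D * U * V         ∎
    where
    instance
      _ = >-nonZero 0<D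
      _ = >-nonZero 0<U
      _ = >-nonZero (≤-trans 0<p p≤V)
      _ = m*n≢0 U V

DivisibilityMaximum : List ℕ → ℕ → Set
DivisibilityMaximum xs m = m ∈ xs × All (_∣ m) xs

DivisibilityMaximum-resp-↭ : ∀ {m} → (λ xs → DivisibilityMaximum xs m) Respects _↭_
DivisibilityMaximum-resp-↭ σ (m∈xs , all∣m) = ∈-resp-↭ σ m∈xs , All-resp-↭ σ all∣m

typeA-maximum : ∀ d u v → DivisibilityMaximum (d * u ∷ d * v ∷ d * u * v ∷ []) (d * u * v)
typeA-maximum d u v =
  there (there (here refl)) ,
  m∣m*n v ∷ subst (d * v ∣_) (xy∙z≈xz∙y *-commutativeSemigroup d v u) (m∣m*n u) ∷ ∣-refl ∷ []

proper-divisor-of-prime : ∀ {p n} → Prime p → n ∣ p → n < p → n ≡ 1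
proper-divisor-of-prime pr n∣p n<p with prime⇒irreducible pr n∣p
... | inj₁ n≡1 = n≡1
... | inj₂ n≡p = ⊥-elim (<-irrefl n≡p n<p)

typeB-maximum⇒U≡1⊎V≡1 : ∀ {p D U V m} → Prime p → 0 < D → 0 < U → 0 < V → U < p → V < p →
  DivisibilityMaximum (D * U * V ∷ D * U * p ∷ D * V * p ∷ []) m → U ≡ 1 ⊎ V ≡ 1
typeB-maximum⇒U≡1⊎V≡1 {D = D} {U} _ z<s z<s z<s _ V<p (here refl , _ ∷ DUp∣DUV ∷ _) =
  ⊥-elim (<⇒≱ V<p (∣⇒≤ (*-cancelˡ-∣ (D * U) DUp∣DUV)))
typeB-maximum⇒U≡1⊎V≡1 {D = D} {U} pr z<s z<s z<s _ V<p (there (here refl) , DUV∣DUp ∷ _) =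
  inj₂ (proper-divisor-of-prime pr (*-cancelˡ-∣ (D * U) DUV∣DUp) V<p)
typeB-maximum⇒U≡1⊎V≡1 {p} {D} {U} {V} pr z<s z<s z<s U<p _
                       (there (there (here refl)) , DUV∣DVp ∷ _) =
  inj₁ (proper-divisor-of-prime pr (*-cancelˡ-∣ (D * V) DVU∣DVp) U<p)
  where
  DVU∣DVp : D * V * U ∣ D * V * p
  DVU∣DVp = subst (_∣ D * V * p) (xy∙z≈xz∙y *-commutativeSemigroup D U V) DUV∣DVp

typeB-equation[U≡1]⇔ : ∀ {p D V} → 0 < D → p + 1 + V ≡ 4 * D * 1 * V ⇔ p + 1 ≡ V * (4 * D ∸ 1)
typeB-equation[U≡1]⇔ {p} {D} {V} 0<D =
  mk⇔ (λ eq → +-cancelʳ-≡ V _ _ (trans eq 4DV≡V[4D∸1]+V))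
      (λ eq → trans (cong (_+ V) eq) (sym 4DV≡V[4D∸1]+V))
  where
  open ≡-Reasoning
  4DV≡V[4D∸1]+V : 4 * D * 1 * V ≡ V * (4 * D ∸ 1) + V
  4DV≡V[4D∸1]+V = begin
    4 * D * 1 * V           ≡⟨ cong (_* V) (*-identityʳ (4 * D)) ⟩
    4 * D * V               ≡⟨ *-comm (4 * D) V ⟩
    V * (4 * D)             ≡⟨ cong (V *_) (m∸n+n≡m (≤-trans 0<D (m≤n*m D 4))) ⟨
    V * (4 * D ∸ 1 + 1)     ≡⟨ *-distribˡ-+ V (4 * D ∸ 1) 1 ⟩
    V * (4 * D ∸ 1) + V * 1 ≡⟨ cong (V * (4 * D ∸ 1) +_) (*-identityʳ V) ⟩
    V * (4 * D ∸ 1) + V     ∎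

typeB-equation-sym : ∀ p D U V → p + U + V ≡ 4 * D * U * V → p + V + U ≡ 4 * D * V * U
typeB-equation-sym p D U V eq =
  trans (xy∙z≈xz∙y +-commutativeSemigroup p V U)
        (trans eq (xy∙z≈xz∙y *-commutativeSemigroup (4 * D) U V))

typeB-equation⇒4D∸1∣p+1 : ∀ p D U V → 0 < D → p + U + V ≡ 4 * D * U * V → U ≡ 1 →
                          (4 * D ∸ 1) ∣ p + 1
typeB-equation⇒4D∸1∣p+1 p D _ V 0<D eq refl = divides V (Equivalence.to (typeB-equation[U≡1]⇔ 0<D) eq)

TypeA∩TypeBSolution : ℕ → Set
TypeA∩TypeBSolution p =
  ∃[ x ] ∃[ y ] ∃[ z ] (0 < x × 0 < y × 0 < z × ESSolution p x y z ×
    (∃[ d ] ∃[ u ] ∃[ v ] ∃[ D ] ∃[ U ] ∃[ V ]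
      (0 < d × 0 < u × 0 < v × 0 < D × 0 < U × 0 < V ×
       SameUpToOrder x y z (d * u) (d * v) (d * u * v) ×
       SameUpToOrder x y z (D * U * V) (D * U * p) (D * V * p))))

-- (dk, dp, dkp) is of Type A with (d, k, p) and of Type B with (d, 1, k).
divisor⇒typeA∩typeB-solution : ∀ {p d k} → 0 < p → 0 < d → p + 1 ≡ k * (4 * d ∸ 1) →
                               TypeA∩TypeBSolution p
divisor⇒typeA∩typeB-solution {k = zero} _ _ p+1≡0 = ⊥-elim (m+1+n≢0 _ p+1≡0)
divisor⇒typeA∩typeB-solution {p} {d} {k@(suc _)} z<s z<s p+1≡k[4d∸1] =
  d * 1 * k , d * 1 * p , d * k * p , z<s , z<s , z<s ,
  typeB-equation⇒solution {p} {d} {1} {k}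
    (Equivalence.from (typeB-equation[U≡1]⇔ {p} {d} {k} z<s) p+1≡k[4d∸1]) ,
  d , k , p , d , 1 , k , z<s , z<s , z<s , z<s , z<s , z<s ,
  ↭-reflexive (cong (λ e → e * k ∷ e * p ∷ d * k * p ∷ []) (*-identityʳ d)) ,
  ↭-refl

proposition6 : (p : ℕ) → Prime p →
    (∃[ x ] ∃[ y ] ∃[ z ] (0 < x × 0 < y × 0 < z × ESSolution p x y z ×
      (∃[ d ] ∃[ u ] ∃[ v ] ∃[ D ] ∃[ U ] ∃[ V ]
        (0 < d × 0 < u × 0 < v × 0 < D × 0 < U × 0 < V ×
         SameUpToOrder x y z (d * u) (d * v) (d * u * v) ×
         SameUpToOrder x y z (D * U * V) (D * U * p) (D * V * p)))))
    ⇔ (∃[ d ] (0 < d × (4 * d ∸ 1) ∣ (p + 1)))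
proposition6 p pr = mk⇔ divisor-of-solution solution-of-divisor
  where
  0<p : 0 < p
  0<p = >-nonZero⁻¹ p {{prime⇒nonZero pr}}

  solution-of-divisor : ∃[ d ] (0 < d × (4 * d ∸ 1) ∣ (p + 1)) → TypeA∩TypeBSolution p
  solution-of-divisor (d , 0<d , divides k p+1≡k[4d∸1]) =
    divisor⇒typeA∩typeB-solution {p} {d} {k} 0<p 0<d p+1≡k[4d∸1]

  divisor-of-solution : TypeA∩TypeBSolution p → ∃[ d ] (0 < d × (4 * d ∸ 1) ∣ (p + 1))
  divisor-of-solution (_ , _ , _ , _ , _ , _ , es ,
                       d , u , v , D , U , V , _ , _ , _ , 0<D , 0<U , 0<V , typeA , typeB) =
    D , 0<D , [ typeB-equation⇒4D∸1∣p+1 p D U V 0<D eqUV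
              , typeB-equation⇒4D∸1∣p+1 p D V U 0<D eqVU
              ]′ (typeB-maximum⇒U≡1⊎V≡1 pr 0<D 0<U 0<V U<p V<p maximum)
    where
    eqUV : p + U + V ≡ 4 * D * U * V
    eqUV = typeB-solution⇒equation 0<p 0<D 0<U 0<V (ESSolution-resp-↭ p typeB es)
    eqVU : p + V + U ≡ 4 * D * V * U
    eqVU = typeB-equation-sym p D U V eqUV
    U<p : U < p
    U<p = typeB-equation⇒V<p 0<p 0<D 0<V eqVU
    V<p : V < p
    V<p = typeB-equation⇒V<p 0<p 0<D 0<U eqUV
    maximum : DivisibilityMaximum (D * U * V ∷ D * U * p ∷ D * V * p ∷ []) (d * u * v)
    maximum = DivisibilityMaximum-resp-↭ typeB
                (DivisibilityMaximum-resp-↭ (↭-sym typeA) (typeA-maximum d u v))
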